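{- Let $G$ be a finite group and let $x,y\in G$ with $\{o(x),o(y)\}=\{p^m,p^n\}$, where $p$ is a prime and $m,n$ are positive integers with $m>n$. Then $N[x]=N[y]$ in $\mathcal{S}(G)$ if and only if $p^nq\notin\pi_e(G)$ for every prime $q\neq p$.
   Context: The order supergraph $\mathcal{S}(G)$ has vertex set $G$, two distinct vertices $x,y$ adjacent iff $o(x)\mid o(y)$ or $o(y)\mid o(x)$. $N[x]$ is the closed neighborhood of $x$ (vertices at distance at most $1$). $\pi_e(G)$ is the set of element orders of $G$. -}

module Defs where

open import Level using (Level; _⊔_) renaming (suc to lsuc)
open import Algebra.Bundles using (Group)
open import Data.Nat using (ℕ; zero; suc; _<_)
open import Data.Nat.Divisibility using (_∣_)
open import Data.Fin using (Fin)
open import Data.Product using (Σ; ∃; ∃-syntax; _×_; _,_)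
open import Data.Sum using (_⊎_)
open import Relation.Nullary using (¬_; Dec)
open import Relation.Binary.Definitions using (Decidable)

record FiniteGroup (c ℓ : Level) : Set (lsuc (c ⊔ ℓ)) where
  field
    group     : Group c ℓ
  open Group group public
  field
    size      : ℕ
    enum      : Fin size → Carrier
    enum-surj : ∀ g → ∃[ i ] (enum i ≈ g)
    _≟_       : Decidable _≈_

module _ {c ℓ : Level} (G : FiniteGroup c ℓ) where
  open FiniteGroup G

  pow : Carrier → ℕ → Carrier
  pow g zero    = ε
  pow g (suc k) = g ∙ pow g k

  HasOrder : Carrier → ℕ → Set ℓ
  HasOrder g k = (0 < k) × (pow g k ≈ ε) × (∀ j → 0 < j → j < k → ¬ (pow g j ≈ ε))

  InSpectrum : ℕ → Set (c ⊔ ℓ)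
  InSpectrum k = ∃[ g ] HasOrder g k

  Adjacent : Carrier → Carrier → Set ℓ
  Adjacent x y = ¬ (x ≈ y) × ∃[ a ] ∃[ b ] (HasOrder x a × HasOrder y b × (a ∣ b ⊎ b ∣ a))

  ClosedNbhd : Carrier → Carrier → Set ℓ
  ClosedNbhd x z = z ≈ x ⊎ Adjacent x z

  SameClosedNbhd : Carrier → Carrier → Set (c ⊔ ℓ)
  SameClosedNbhd x y = ∀ z → (ClosedNbhd x z → ClosedNbhd y z) × (ClosedNbhd y z → ClosedNbhd x z)

-- In the order supergraph the closed neighbourhood of x consists exactly of the
-- elements whose order is comparable with o(x) under divisibility, so N[x] = N[y]
-- says that p^m and p^n are comparable with the same element orders. As π_e(G) is
-- closed under divisors, an order comparable with p^n but not with p^m is divisible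
-- by p^n without being a power of p, hence divisible by some p^n q ∈ π_e(G) with
-- q ≠ p prime; conversely such a p^n q is comparable with p^n but not with p^m.
module Submission where

open import Defs
open import Level using (Level)
open import Data.Empty using (⊥-elim)
open import Data.List using ([]; _∷_; length)
open import Data.List.Membership.Propositional using (find)
open import Data.List.Relation.Unary.All using (All; []; _∷_; all?; lookup)
open import Data.List.Relation.Unary.All.Properties using (¬All⇒Any¬)
open import Data.Nat using (ℕ; zero; suc; _+_; _*_; _^_; _<_; _≤_; _∸_; NonZero; >-nonZero; >-nonZero⁻¹)
open import Data.Nat.Divisibility
open import Data.Nat.ListAction using (product)
open import Data.Nat.ListAction.Properties using (∈⇒∣product)
open import Data.Nat.Primality using (Prime; ¬prime[1]; prime⇒nonZero; prime⇒irreducible; euclidsLemma)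
open import Data.Nat.Primality.Factorisation using (factorise)
open import Data.Nat.Properties
open import Data.Product using (_×_; _,_; proj₁; proj₂; ∃-syntax)
open import Data.Sum using (_⊎_; inj₁; inj₂)
import Data.Sum as Sum
open import Function.Bundles using (_⇔_; mk⇔; Equivalence)
import Function.Properties.Equivalence as ⇔
open import Relation.Nullary using (¬_; yes; no)
open import Relation.Binary.Definitions using (tri<; tri≈; tri>)
open import Relation.Unary using (Pred; _⊆′_)
open import Relation.Binary.PropositionalEquality as ≡ using (_≡_; _≢_)

Comparable : ℕ → ℕ → Set
Comparable a b = a ∣ b ⊎ b ∣ a

PowerOf : ℕ → ℕ → Set
PowerOf p a = ∃[ k ] a ≡ p ^ k

ComparableAlike : ∀ {ℓ} → Pred ℕ ℓ → ℕ → ℕ → Set ℓ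
ComparableAlike S a b = ∀ c → S c → Comparable a c ⇔ Comparable b c

^-monoʳ-∣ : ∀ p {k j} → k ≤ j → p ^ k ∣ p ^ j
^-monoʳ-∣ p {k} {j} k≤j = ≡.subst (p ^ k ∣_) p^k*p^[j∸k]≡p^j (m∣m*n (p ^ (j ∸ k)))
  where
  p^k*p^[j∸k]≡p^j : p ^ k * p ^ (j ∸ k) ≡ p ^ j
  p^k*p^[j∸k]≡p^j = ≡.trans (≡.sym (^-distribˡ-+-* p k (j ∸ k))) (≡.cong (p ^_) (m+[n∸m]≡n k≤j))

comparable-^ : ∀ p k j → Comparable (p ^ k) (p ^ j)
comparable-^ p k j = Sum.map (^-monoʳ-∣ p) (^-monoʳ-∣ p) (≤-total k j)

prime∣prime⇒≡ : ∀ {p q} → Prime p → Prime q → q ∣ p → q ≡ p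
prime∣prime⇒≡ pp qp q∣p with prime⇒irreducible pp q∣p
... | inj₁ q≡1 = ⊥-elim (¬prime[1] (≡.subst Prime q≡1 qp))
... | inj₂ q≡p = q≡p

prime∣^⇒≡ : ∀ {p q} k → Prime p → Prime q → q ∣ p ^ k → q ≡ p
prime∣^⇒≡ zero    pp qp q∣1 = ⊥-elim (¬prime[1] (≡.subst Prime (∣1⇒≡1 q∣1) qp))
prime∣^⇒≡ {p} (suc k) pp qp q∣p^[1+k] with euclidsLemma p (p ^ k) qp q∣p^[1+k]
... | inj₁ q∣p   = prime∣prime⇒≡ pp qp q∣p
... | inj₂ q∣p^k = prime∣^⇒≡ k pp qp q∣p^k

product≡^length : ∀ {p} ps → All (_≡ p) ps → product ps ≡ p ^ length ps
product≡^length []       []            = ≡.refl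
product≡^length (q ∷ ps) (≡.refl ∷ qs) = ≡.cong (q *_) (product≡^length ps qs)

powerOf⊎otherPrimeFactor : ∀ p a → .{{NonZero a}} →
  PowerOf p a ⊎ ∃[ q ] (Prime q × q ≢ p × q ∣ a)
powerOf⊎otherPrimeFactor p a with factorise a
... | record { factors = ps ; isFactorisation = a≡∏ps ; factorsPrime = primes } with all? (_≟ p) ps
...   | yes all≡p = inj₁ (length ps , ≡.trans a≡∏ps (product≡^length ps all≡p))
...   | no ¬all≡p with find (¬All⇒Any¬ (_≟ p) ps ¬all≡p)
...     | q , q∈ps , q≢p =
  inj₂ (q , lookup primes q∈ps , q≢p , ≡.subst (q ∣_) (≡.sym a≡∏ps) (∈⇒∣product q∈ps))

∣⇒nonZero : ∀ {a b} → .{{NonZero b}} → a ∣ b → NonZero a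
∣⇒nonZero {b = b} {{b≢0}} (divides r b≡r*a) = m*n≢0⇒n≢0 r {{≡.subst NonZero b≡r*a b≢0}}

∣^⇒powerOf : ∀ {p a} m → Prime p → a ∣ p ^ m → PowerOf p a
∣^⇒powerOf {p} {a} m pp a∣p^m
  with powerOf⊎otherPrimeFactor p a {{∣⇒nonZero {{m^n≢0 p m {{prime⇒nonZero pp}}}} a∣p^m}}
... | inj₁ a≡p^k                 = a≡p^k
... | inj₂ (q , qp , q≢p , q∣a) = ⊥-elim (q≢p (prime∣^⇒≡ m pp qp (∣-trans q∣a a∣p^m)))

^*prime-incomparable : ∀ {p q m n} → Prime p → Prime q → q ≢ p → n < m →
  ¬ Comparable (p ^ m) (p ^ n * q)
^*prime-incomparable {p} {q} {m} {n} pp qp q≢p n<m (inj₁ p^m∣p^n*q) =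
  q≢p (≡.sym (prime∣prime⇒≡ qp pp p∣q))
  where
  instance _ = m^n≢0 p n {{prime⇒nonZero pp}}
  p^n*p∣p^n*q : p ^ n * p ∣ p ^ n * q
  p^n*p∣p^n*q = ∣-trans (∣-reflexive (*-comm (p ^ n) p)) (∣-trans (^-monoʳ-∣ p n<m) p^m∣p^n*q)
  p∣q : p ∣ q
  p∣q = *-cancelˡ-∣ (p ^ n) p^n*p∣p^n*q
^*prime-incomparable {p} {q} {m} {n} pp qp q≢p _ (inj₂ p^n*q∣p^m) =
  q≢p (prime∣^⇒≡ m pp qp (m*n∣⇒n∣ (p ^ n) q p^n*q∣p^m))

^∣⇒powerOf⊎^*prime∣ : ∀ {p n c} → .{{NonZero c}} → p ^ n ∣ c →
  PowerOf p c ⊎ ∃[ q ] (Prime q × q ≢ p × p ^ n * q ∣ c)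
^∣⇒powerOf⊎^*prime∣ {p} {n} {c} {{c≢0}} (divides r c≡r*p^n)
  with powerOf⊎otherPrimeFactor p r {{m*n≢0⇒m≢0 r {{≡.subst NonZero c≡r*p^n c≢0}}}}
... | inj₁ (k , ≡.refl) =
  inj₁ (k + n , ≡.trans c≡r*p^n (≡.sym (^-distribˡ-+-* p k n)))
... | inj₂ (q , qp , q≢p , q∣r) =
  inj₂ (q , qp , q≢p , ≡.subst (p ^ n * q ∣_) c≡p^n*r (*-monoʳ-∣ (p ^ n) q∣r))
  where
  c≡p^n*r : p ^ n * r ≡ c
  c≡p^n*r = ≡.trans (*-comm (p ^ n) r) (≡.sym c≡r*p^n)

comparableAlike-^⇔ : ∀ {ℓ} (S : Pred ℕ ℓ) → (∀ {a b} → a ∣ b → S b → S a) → (∀ {a} → S a → NonZero a) →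
  ∀ {p m n} → Prime p → n < m →
  ComparableAlike S (p ^ m) (p ^ n) ⇔ (∀ q → Prime q → q ≢ p → ¬ S (p ^ n * q))
comparableAlike-^⇔ S S-∣ S⇒≢0 {p} {m} {n} pp n<m = mk⇔ noMixedOrder alike
  where
  p^n∣p^m : p ^ n ∣ p ^ m
  p^n∣p^m = ^-monoʳ-∣ p (<⇒≤ n<m)

  noMixedOrder : ComparableAlike S (p ^ m) (p ^ n) → ∀ q → Prime q → q ≢ p → ¬ S (p ^ n * q)
  noMixedOrder agree q qp q≢p S[p^n*q] =
    ^*prime-incomparable pp qp q≢p n<m (Equivalence.from (agree _ S[p^n*q]) (inj₁ (m∣m*n q)))

  alike : (∀ q → Prime q → q ≢ p → ¬ S (p ^ n * q)) → ComparableAlike S (p ^ m) (p ^ n)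
  alike none c Sc = mk⇔ fromHigher fromLower
    where
    fromHigher : Comparable (p ^ m) c → Comparable (p ^ n) c
    fromHigher (inj₁ p^m∣c) = inj₁ (∣-trans p^n∣p^m p^m∣c)
    fromHigher (inj₂ c∣p^m) with ∣^⇒powerOf m pp c∣p^m
    ... | k , ≡.refl = comparable-^ p n k

    fromLower : Comparable (p ^ n) c → Comparable (p ^ m) c
    fromLower (inj₂ c∣p^n) = inj₂ (∣-trans c∣p^n p^n∣p^m)
    fromLower (inj₁ p^n∣c) with ^∣⇒powerOf⊎^*prime∣ {p} {n} {{S⇒≢0 Sc}} p^n∣c
    ... | inj₁ (k , ≡.refl)          = comparable-^ p m k
    ... | inj₂ (q , qp , q≢p , p^n*q∣c) = ⊥-elim (none q qp q≢p (S-∣ p^n*q∣c Sc))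

module _ {c ℓ : Level} (G : FiniteGroup c ℓ) where
  open FiniteGroup G using (_≈_; _∙_; monoid; setoid)
    renaming (_≟_ to _≈?_; sym to ≈-sym; trans to ≈-trans)
  open import Algebra.Properties.Monoid.Mult monoid using (×-congʳ; ×-assocˡ)
    renaming (_×_ to _·_)
  open import Relation.Binary.Reasoning.Setoid setoid

  pow≡· : ∀ g k → pow G g k ≡ k · g
  pow≡· g zero    = ≡.refl
  pow≡· g (suc k) = ≡.cong (g ∙_) (pow≡· g k)

  pow-cong : ∀ {g h} k → g ≈ h → pow G g k ≈ pow G h k
  pow-cong {g} {h} k g≈h = begin
    pow G g k ≡⟨ pow≡· g k ⟩
    k · g     ≈⟨ ×-congʳ k g≈h ⟩
    k · h     ≡⟨ pow≡· h k ⟨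
    pow G h k ∎

  pow-pow : ∀ g d k → pow G (pow G g d) k ≈ pow G g (d * k)
  pow-pow g d k = begin
    pow G (pow G g d) k ≡⟨ pow≡· (pow G g d) k ⟩
    k · pow G g d       ≡⟨ ≡.cong (k ·_) (pow≡· g d) ⟩
    k · (d · g)         ≈⟨ ×-assocˡ g k d ⟩
    (k * d) · g         ≡⟨ ≡.cong (_· g) (*-comm k d) ⟩
    (d * k) · g         ≡⟨ pow≡· g (d * k) ⟨
    pow G g (d * k)     ∎

  HasOrder-unique : ∀ {g a b} → HasOrder G g a → HasOrder G g b → a ≡ b
  HasOrder-unique {a = a} {b} (0<a , g^a≈ε , a-least) (0<b , g^b≈ε , b-least) with <-cmp a b
  ... | tri< a<b _ _ = ⊥-elim (b-least a 0<a a<b g^a≈ε)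
  ... | tri≈ _ a≡b _ = a≡b
  ... | tri> _ _ b<a = ⊥-elim (a-least b 0<b b<a g^b≈ε)

  HasOrder-resp-≈ : ∀ {g h a} → g ≈ h → HasOrder G g a → HasOrder G h a
  HasOrder-resp-≈ {a = a} g≈h (0<a , g^a≈ε , a-least) =
    0<a , ≈-trans (pow-cong a (≈-sym g≈h)) g^a≈ε ,
    λ j 0<j j<a h^j≈ε → a-least j 0<j j<a (≈-trans (pow-cong j g≈h) h^j≈ε)

  HasOrder-pow : ∀ {g} d {e} → HasOrder G g (d * e) → HasOrder G (pow G g d) e
  HasOrder-pow {g} d {e} (0<de , g^de≈ε , de-least) =
    >-nonZero⁻¹ e , ≈-trans (pow-pow g d e) g^de≈ε ,
    λ j 0<j j<e g^dj≈ε → de-least (d * j) (>-nonZero⁻¹ (d * j) {{m*n≢0 d j {{d≢0}} {{>-nonZero 0<j}}}})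
      (*-monoʳ-< d j<e) (≈-trans (≈-sym (pow-pow g d j)) g^dj≈ε)
    where
    instance
      de≢0 : NonZero (d * e)
      de≢0 = >-nonZero 0<de
      d≢0 : NonZero d
      d≢0 = m*n≢0⇒m≢0 d
      e≢0 : NonZero e
      e≢0 = m*n≢0⇒n≢0 d

  InSpectrum-∣ : ∀ {a b} → a ∣ b → InSpectrum G b → InSpectrum G a
  InSpectrum-∣ (divides r ≡.refl) (g , g-order) = pow G g r , HasOrder-pow r g-order

  InSpectrum⇒NonZero : ∀ {a} → InSpectrum G a → NonZero a
  InSpectrum⇒NonZero (_ , 0<a , _) = >-nonZero 0<a

  ClosedNbhd⇒Comparable : ∀ {x z a} → HasOrder G x a → ClosedNbhd G x z →
    ∃[ b ] (HasOrder G z b × Comparable a b)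
  ClosedNbhd⇒Comparable {a = a} x-order (inj₁ z≈x) =
    a , HasOrder-resp-≈ (≈-sym z≈x) x-order , inj₁ ∣-refl
  ClosedNbhd⇒Comparable x-order (inj₂ (_ , a′ , b , x-order′ , z-order , a′~b))
    rewrite HasOrder-unique x-order x-order′ = b , z-order , a′~b

  Comparable⇒ClosedNbhd : ∀ {x z a b} → HasOrder G x a → HasOrder G z b → Comparable a b →
    ClosedNbhd G x z
  Comparable⇒ClosedNbhd {x} {z} x-order z-order a~b with z ≈? x
  ... | yes z≈x = inj₁ z≈x
  ... | no z≉x  = inj₂ ((λ x≈z → z≉x (≈-sym x≈z)) , _ , _ , x-order , z-order , a~b)

  ClosedNbhd-⊆⇒ : ∀ {x y a b} → HasOrder G x a → HasOrder G y b →
    ClosedNbhd G x ⊆′ ClosedNbhd G y → ∀ c → InSpectrum G c → Comparable a c → Comparable b c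
  ClosedNbhd-⊆⇒ x-order y-order N[x]⊆N[y] c (g , g-order) a~c
    with ClosedNbhd⇒Comparable y-order (N[x]⊆N[y] g (Comparable⇒ClosedNbhd x-order g-order a~c))
  ... | c′ , g-order′ , b~c′ rewrite HasOrder-unique g-order g-order′ = b~c′

  ⇒ClosedNbhd-⊆ : ∀ {x y a b} → HasOrder G x a → HasOrder G y b →
    (∀ c → InSpectrum G c → Comparable a c → Comparable b c) → ClosedNbhd G x ⊆′ ClosedNbhd G y
  ⇒ClosedNbhd-⊆ x-order y-order a~⇒b~ z z∈N[x] with ClosedNbhd⇒Comparable x-order z∈N[x]
  ... | c , z-order , a~c = Comparable⇒ClosedNbhd y-order z-order (a~⇒b~ c (z , z-order) a~c)

  SameClosedNbhd⇔ComparableAlike : ∀ {x y a b} → HasOrder G x a → HasOrder G y b →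
    SameClosedNbhd G x y ⇔ ComparableAlike (InSpectrum G) a b
  SameClosedNbhd⇔ComparableAlike x-order y-order = mk⇔
    (λ same c c∈πₑ → mk⇔ (ClosedNbhd-⊆⇒ x-order y-order (λ z → proj₁ (same z)) c c∈πₑ)
                         (ClosedNbhd-⊆⇒ y-order x-order (λ z → proj₂ (same z)) c c∈πₑ))
    (λ alike z → ⇒ClosedNbhd-⊆ x-order y-order (λ c c∈πₑ → Equivalence.to (alike c c∈πₑ)) z
               , ⇒ClosedNbhd-⊆ y-order x-order (λ c c∈πₑ → Equivalence.from (alike c c∈πₑ)) z)

  SameClosedNbhd-sym⇔ : ∀ {x y} → SameClosedNbhd G x y ⇔ SameClosedNbhd G y x
  SameClosedNbhd-sym⇔ = mk⇔ swap swap
    where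
    swap : ∀ {x y} → SameClosedNbhd G x y → SameClosedNbhd G y x
    swap same z = proj₂ (same z) , proj₁ (same z)

corollary3p5 : ∀ {c ℓ : Level} (G : FiniteGroup c ℓ) (x y : FiniteGroup.Carrier G)
    (p m n : ℕ) → Prime p → 0 < m → 0 < n → n < m →
    ((HasOrder G x (p ^ m) × HasOrder G y (p ^ n)) ⊎ (HasOrder G x (p ^ n) × HasOrder G y (p ^ m))) →
    (SameClosedNbhd G x y → ∀ q → Prime q → ¬ (q ≡ p) → ¬ InSpectrum G (p ^ n * q))
    × ((∀ q → Prime q → ¬ (q ≡ p) → ¬ InSpectrum G (p ^ n * q)) → SameClosedNbhd G x y)
corollary3p5 G x y p m n pp _ _ n<m orders = Equivalence.to criterion , Equivalence.from criterion
  where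
  spectrumCriterion : ComparableAlike (InSpectrum G) (p ^ m) (p ^ n) ⇔
    (∀ q → Prime q → q ≢ p → ¬ InSpectrum G (p ^ n * q))
  spectrumCriterion = comparableAlike-^⇔ (InSpectrum G) (InSpectrum-∣ G) (InSpectrum⇒NonZero G) pp n<m

  criterion : SameClosedNbhd G x y ⇔ (∀ q → Prime q → q ≢ p → ¬ InSpectrum G (p ^ n * q))
  criterion = Sum.[
      (λ (x-order , y-order) →
        ⇔.trans (SameClosedNbhd⇔ComparableAlike G x-order y-order) spectrumCriterion)
    , (λ (x-order , y-order) →
        ⇔.trans (SameClosedNbhd-sym⇔ G)
          (⇔.trans (SameClosedNbhd⇔ComparableAlike G y-order x-order) spectrumCriterion))
    ] orders
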